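{- Let $\alpha\in\mathbb N_0^N$, $T\in Y(\tau)$, $\varepsilon\in\{+1,-1\}$, and $i\in[1,N-1]$ with $\alpha_i>\alpha_{i+1}$. Then $\mathcal E_\varepsilon(s_i\alpha,T)/\mathcal E_\varepsilon(\alpha,T)=1+\varepsilon\,b_i(\alpha,T)$.
   Context: $N\ge2$, $\tau$ a partition of $N$, $\kappa$ an indeterminate. $Y(\tau)$: reversed standard Young tableaux of shape $\tau$ (bijective fillings of the Ferrers diagram by $1,\dots,N$, strictly decreasing along rows and down columns); $c(i,T)=\mathrm{cm}(i,T)-\mathrm{rw}(i,T)$ where $\mathrm{rw},\mathrm{cm}$ are row and column of the node containing $i$. For $\alpha\in\mathbb N_0^N$: $r(\alpha,i)=\#\{j:\alpha_j>\alpha_i\}+\#\{j\le i:\alpha_j=\alpha_i\}$; $s_i\alpha$ is $\alpha$ with entries $i,i+1$ interchanged; $b_i(\alpha,T)=\kappa/\bigl(\alpha_i-\alpha_{i+1}+\kappa(c(r(\alpha,i),T)-c(r(\alpha,i+1),T))\bigr)$; $\mathcal E_\varepsilon(\alpha,T)=\prod_{1\le i<j\le N,\ \alpha_i<\alpha_j}\Bigl(1+\frac{\varepsilon\kappa}{\alpha_j-\alpha_i+\kappa(c(r(\alpha,j),T)-c(r(\alpha,i),T))}\Bigr)$ (rational functions of $\kappa$). -}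

module Defs where

open import Data.Nat as ℕ using (ℕ; zero; suc; _<_; _>_; _≤_)
open import Data.Nat.Properties using (_<?_; _>?_; _≤?_; _≟_)
open import Relation.Nullary.Decidable using (_×-dec_)
open import Data.Integer as ℤ using (ℤ; +_)
open import Data.Rational as ℚ using (ℚ; 0ℚ; 1ℚ; _/_; 1/_; ≢-nonZero)
import Data.Rational.Properties as ℚP
open import Data.Fin as Fin using (Fin; toℕ; fromℕ<)
open import Data.Nat.ListAction using (sum)
open import Data.List as List using (List; []; _∷_; length; allFin; filter; concatMap; foldr)
open import Data.Product using (_×_; _,_; proj₁; proj₂)
open import Relation.Nullary using (Dec; yes; no; ¬_)
open import Relation.Binary.PropositionalEquality using (_≡_; _≢_)
open import Function.Definitions using (Injective)

data Decreasing : List ℕ → Set where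
  dec-[]  : Decreasing []
  dec-one : ∀ a → Decreasing (a ∷ [])
  dec-∷   : ∀ {a b l} → b ≤ a → Decreasing (b ∷ l) → Decreasing (a ∷ b ∷ l)

data AllPositive : List ℕ → Set where
  pos-[] : AllPositive []
  pos-∷  : ∀ {a l} → 0 < a → AllPositive l → AllPositive (a ∷ l)

IsPartition : ℕ → List ℕ → Set
IsPartition N τ = Decreasing τ × AllPositive τ × (sum τ ≡ N)

rowLen : List ℕ → ℕ → ℕ
rowLen []      _       = 0
rowLen (a ∷ _) zero    = a
rowLen (_ ∷ τ) (suc r) = rowLen τ r

-- node (row , column), both 0-based, of the Ferrers diagram of τ
InDiagram : List ℕ → ℕ × ℕ → Set
InDiagram τ (r , c) = c < rowLen τ r

-- A filling of the diagram of τ by 1..N is recorded as the map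
-- sending the entry (k : Fin N stands for the number toℕ k + 1) to its node.
-- Reversed standard Young tableau: bijective onto the diagram (injective, lands in
-- the diagram, and the diagram has N nodes since τ ⊢ N), strictly decreasing along
-- rows (left to right) and down columns (top to bottom).
record RSYT (N : ℕ) (τ : List ℕ) : Set where
  field
    node       : Fin N → ℕ × ℕ
    inDiagram  : ∀ k → InDiagram τ (node k)
    injective  : Injective _≡_ _≡_ node
    rowDecr    : ∀ a b → proj₁ (node a) ≡ proj₁ (node b) →
                 proj₂ (node a) < proj₂ (node b) → toℕ a > toℕ b
    colDecr    : ∀ a b → proj₂ (node a) ≡ proj₂ (node b) →
                 proj₁ (node a) < proj₁ (node b) → toℕ a > toℕ b

open RSYT public

-- content c(m,T) = cm(m,T) - rw(m,T), for m ∈ [1,N] given as a natural number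
-- (value 0 outside [1,N]; never used there).
content : ∀ {N τ} → RSYT N τ → ℕ → ℤ
content {N} T zero = + 0
content {N} T (suc m) with m <? N
... | yes m<N = let (r , c) = node T (fromℕ< m<N) in (+ c) ℤ.- (+ r)
... | no _    = + 0


-- compositions α ∈ ℕ₀^N, indexed by Fin N (position k stands for index toℕ k + 1)
Comp : ℕ → Set
Comp N = Fin N → ℕ

rank : ∀ {N} → Comp N → Fin N → ℕ
rank {N} α i =
  length (filter (λ j → α j >? α i) (allFin N)) ℕ.+
  length (filter (λ j → (toℕ j ≤? toℕ i) ×-dec (α j ≟ α i)) (allFin N))

-- s_i α : interchange the entries at positions i and j (used with j = i + 1)
swapAt : ∀ {N} → Fin N → Fin N → Comp N → Comp N
swapAt i j α k with k Fin.≟ i | k Fin.≟ j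
... | yes _ | _     = α j
... | no _  | yes _ = α i
... | no _  | no _  = α k

-- Rational arithmetic (κ is specialised to a rational number)

toℚ : ℤ → ℚ
toℚ z = z / 1

-- inverse, with the (never used) convention 1/0 = 0; all theorems assume the
-- relevant denominators are nonzero
inv : ℚ → ℚ
inv q with q ℚP.≟ 0ℚ
... | yes _ = 0ℚ
... | no q≢0 = 1/_ q {{≢-nonZero q≢0}}

prodℚ : List ℚ → ℚ
prodℚ = foldr ℚ._*_ 1ℚ

denom : ∀ {N τ} → RSYT N τ → ℚ → Comp N → Fin N → Fin N → ℚ
denom T κ α a b =
  toℚ ((+ α b) ℤ.- (+ α a)) ℚ.+ κ ℚ.* toℚ (content T (rank α b) ℤ.- content T (rank α a))

incPairs : ∀ {N} → Comp N → List (Fin N × Fin N)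
incPairs {N} α =
  filter (λ p → (toℕ (proj₁ p) <? toℕ (proj₂ p)) ×-dec (α (proj₁ p) <? α (proj₂ p)))
         (concatMap (λ a → List.map (a ,_) (allFin N)) (allFin N))

𝓔 : ∀ {N τ} → RSYT N τ → ℚ → ℚ → Comp N → ℚ
𝓔 T κ ε α =
  prodℚ (List.map (λ p → 1ℚ ℚ.+ ε ℚ.* κ ℚ.* inv (denom T κ α (proj₁ p) (proj₂ p))) (incPairs α))

bDenom : ∀ {N τ} → RSYT N τ → ℚ → Comp N → Fin N → Fin N → ℚ
bDenom T κ α i j =
  toℚ ((+ α i) ℤ.- (+ α j)) ℚ.+ κ ℚ.* toℚ (content T (rank α i) ℤ.- content T (rank α j))

bCoeff : ∀ {N τ} → RSYT N τ → ℚ → Comp N → Fin N → Fin N → ℚ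
bCoeff T κ α i j = κ ℚ.* inv (bDenom T κ α i j)

-- κ avoids the finitely many values at which some denominator in the statement vanishes
Admissible : ∀ {N τ} → RSYT N τ → ℚ → ℚ → Comp N → Fin N → Fin N → Set
Admissible T κ ε α i j =
  (∀ a b → toℕ a ℕ.< toℕ b → α a ℕ.< α b → denom T κ α a b ≢ 0ℚ) ×
  (∀ a b → toℕ a ℕ.< toℕ b → swapAt i j α a ℕ.< swapAt i j α b →
           denom T κ (swapAt i j α) a b ≢ 0ℚ) ×
  (bDenom T κ α i j ≢ 0ℚ) ×
  (𝓔 T κ ε α ≢ 0ℚ)

{-# OPTIONS --safe #-}
module Submission where

-- Let σ be the transposition of the adjacent positions i and j = i + 1, so that s_i α = α ∘ σ.
-- Outside the pair {i, j}, σ preserves the order of positions, and i, j carry distinct values;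
-- hence σ preserves ranks, r(s_i α, σ k) = r(α, k), and the factor of 𝓔(s_i α) at (σ a, σ b)
-- equals the factor of 𝓔(α) at (a, b). Reindexing the product by σ, every pair contributes to
-- 𝓔(s_i α) iff it contributes to 𝓔(α), except (a, b) = (j, i): it contributes after the swap
-- only, with the factor 1 + ε κ / (α_i − α_j + κ (c(r(α,i)) − c(r(α,j)))) = 1 + ε b_i(α, T).

open import Defs
open import Data.Nat using (ℕ; _≤_; _>_; suc)
open import Data.Fin using (Fin; toℕ)
open import Data.List using (List)
open import Data.Rational using (ℚ; 1ℚ; _+_; _*_; -_)
open import Data.Sum using (_⊎_)
open import Relation.Binary.PropositionalEquality using (_≡_)

open import Level using (0ℓ)
open import Data.Bool.Base using (true; false; if_then_else_)
import Data.Nat as ℕ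
import Data.Nat.Properties as ℕP
open import Data.Integer as ℤ using (+_)
import Data.Fin as Fin
open import Data.Fin using (_≟_; punchIn)
open import Data.Fin.Properties using (toℕ-injective; punchInᵢ≢i)
open import Data.Fin.Permutation as Perm using (Permutation; _⟨$⟩ʳ_)
open import Data.Fin.Permutation.Components using (transpose)
open import Data.List using (_∷_; []; _++_; map; length; filter; tabulate; allFin; concatMap)
import Data.List.Properties as ListP
open import Data.Product using (_×_; _,_; proj₁; proj₂)
open import Data.Rational using (0ℚ; ≢-nonZero)
import Data.Rational.Properties as ℚP
open import Data.Sum using (inj₁; inj₂)
open import Data.Vec.Functional using (replicate)
open import Function using (_∘_; id; _⇔_; mk⇔; Equivalence)
open import Relation.Nullary using (¬_; Dec; does; yes; no; contradiction)
open import Relation.Nullary.Decidable using (_×-dec_; does-⇔; dec-true; dec-false)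
open import Relation.Unary using (Pred; Decidable)
open import Relation.Binary.PropositionalEquality
  using (_≢_; refl; sym; trans; cong; cong₂; subst; subst₂; module ≡-Reasoning)

open import Algebra.Properties.CommutativeMonoid.Sum ℚP.*-1-commutativeMonoid
  using () renaming (sum to ∏; sum-cong-≗ to ∏-cong; sum-permute to ∏-permute;
                     ∑-distrib-+ to ∏-distrib-*; sum-remove to ∏-remove;
                     sum-replicate-zero to ∏-replicate-one)
open import Algebra.Properties.CommutativeMonoid.Sum ℕP.+-0-commutativeMonoid
  using () renaming (sum to ∑; sum-cong-≗ to ∑-cong; sum-permute to ∑-permute)

private variable
  A B : Set
  n : ℕ

prodℚ-++ : (xs ys : List ℚ) → prodℚ (xs ++ ys) ≡ prodℚ xs * prodℚ ys
prodℚ-++ []       ys = sym (ℚP.*-identityˡ _)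
prodℚ-++ (x ∷ xs) ys = trans (cong (x *_) (prodℚ-++ xs ys)) (sym (ℚP.*-assoc x _ _))

prodℚ-map-filter : {P : Pred A 0ℓ} (P? : Decidable P) (g : A → ℚ) (xs : List A) →
  prodℚ (map g (filter P? xs)) ≡
  prodℚ (map (λ x → if does (P? x) then g x else 1ℚ) xs)
prodℚ-map-filter P? g []       = refl
prodℚ-map-filter P? g (x ∷ xs) with does (P? x)
... | true  = cong (g x *_) (prodℚ-map-filter P? g xs)
... | false = trans (prodℚ-map-filter P? g xs) (sym (ℚP.*-identityˡ _))

prodℚ-map-concatMap : (g : B → ℚ) (f : A → List B) (xs : List A) →
  prodℚ (map g (concatMap f xs)) ≡ prodℚ (map (prodℚ ∘ map g ∘ f) xs)
prodℚ-map-concatMap g f []       = refl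
prodℚ-map-concatMap g f (x ∷ xs) = begin
  prodℚ (map g (f x ++ concatMap f xs))                ≡⟨ cong prodℚ (ListP.map-++ g (f x) _) ⟩
  prodℚ (map g (f x) ++ map g (concatMap f xs))        ≡⟨ prodℚ-++ (map g (f x)) _ ⟩
  prodℚ (map g (f x)) * prodℚ (map g (concatMap f xs))
    ≡⟨ cong (prodℚ (map g (f x)) *_) (prodℚ-map-concatMap g f xs) ⟩
  prodℚ (map g (f x)) * prodℚ (map (prodℚ ∘ map g ∘ f) xs) ∎
  where open ≡-Reasoning

prodℚ-tabulate : (f : Fin n → ℚ) → prodℚ (tabulate f) ≡ ∏ f
prodℚ-tabulate {ℕ.zero}  f = refl
prodℚ-tabulate {ℕ.suc n} f = cong (f Fin.zero *_) (prodℚ-tabulate (f ∘ Fin.suc))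

prodℚ-map-allFin : (g : Fin n → ℚ) → prodℚ (map g (allFin n)) ≡ ∏ g
prodℚ-map-allFin g = trans (cong prodℚ (ListP.map-tabulate id g)) (prodℚ-tabulate g)

∏-single : (f : Fin n → ℚ) (i : Fin n) → (∀ k → k ≢ i → f k ≡ 1ℚ) → ∏ f ≡ f i
∏-single {ℕ.suc n} f i others-one = begin
  ∏ f                     ≡⟨ ∏-remove f ⟩
  f i * ∏ (f ∘ punchIn i) ≡⟨ cong (f i *_) (∏-cong (λ k → others-one _ (punchInᵢ≢i i k))) ⟩
  f i * ∏ (replicate n 1ℚ) ≡⟨ cong (f i *_) (∏-replicate-one n) ⟩
  f i * 1ℚ                ≡⟨ ℚP.*-identityʳ (f i) ⟩
  f i                     ∎
  where open ≡-Reasoning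

∏∏-single : {m : ℕ} (a₀ : Fin m) (b₀ : Fin n) (t : ℚ) →
  ∏ (λ a → ∏ (λ b → if does ((a ≟ a₀) ×-dec (b ≟ b₀)) then t else 1ℚ)) ≡ t
∏∏-single a₀ b₀ t = begin
  ∏ (λ a → ∏ (λ b → δ a b))
    ≡⟨ ∏-cong (λ a → ∏-single (δ a) b₀ (λ b b≢b₀ → off a b (b≢b₀ ∘ proj₂))) ⟩
  ∏ (λ a → δ a b₀)
    ≡⟨ ∏-single (λ a → δ a b₀) a₀ (λ a a≢a₀ → off a b₀ (a≢a₀ ∘ proj₁)) ⟩
  δ a₀ b₀
    ≡⟨ cong (if_then t else 1ℚ) (dec-true ((a₀ ≟ a₀) ×-dec (b₀ ≟ b₀)) (refl , refl)) ⟩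
  t ∎
  where
  open ≡-Reasoning
  δ : Fin _ → Fin _ → ℚ
  δ a b = if does ((a ≟ a₀) ×-dec (b ≟ b₀)) then t else 1ℚ
  off : ∀ a b → ¬ (a ≡ a₀ × b ≡ b₀) → δ a b ≡ 1ℚ
  off a b ¬ab = cong (if_then t else 1ℚ) (dec-false ((a ≟ a₀) ×-dec (b ≟ b₀)) ¬ab)

length-filter-tabulate : {P : Pred A 0ℓ} (P? : Decidable P) (f : Fin n → A) →
  length (filter P? (tabulate f)) ≡ ∑ (λ k → if does (P? (f k)) then 1 else 0)
length-filter-tabulate {n = ℕ.zero}  P? f = refl
length-filter-tabulate {n = ℕ.suc n} P? f with does (P? (f Fin.zero))
... | true  = cong suc (length-filter-tabulate P? (f ∘ Fin.suc))
... | false = length-filter-tabulate P? (f ∘ Fin.suc)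

count-allFin-permute : {P Q : Pred (Fin n) 0ℓ} (P? : Decidable P) (Q? : Decidable Q)
  (π : Permutation n n) → (∀ k → P (π ⟨$⟩ʳ k) ⇔ Q k) →
  length (filter P? (allFin n)) ≡ length (filter Q? (allFin n))
count-allFin-permute {n} P? Q? π P∘π⇔Q = begin
  length (filter P? (allFin n))
    ≡⟨ length-filter-tabulate P? id ⟩
  ∑ (λ k → if does (P? k) then 1 else 0)
    ≡⟨ ∑-permute _ π ⟩
  ∑ (λ k → if does (P? (π ⟨$⟩ʳ k)) then 1 else 0)
    ≡⟨ ∑-cong (λ k → cong (if_then 1 else 0) (does-⇔ (P∘π⇔Q k) (P? _) (Q? k))) ⟩
  ∑ (λ k → if does (Q? k) then 1 else 0)
    ≡⟨ length-filter-tabulate Q? id ⟨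
  length (filter Q? (allFin n)) ∎
  where open ≡-Reasoning

module _ (i j : Fin n) where

  transpose-matchˡ : transpose i j i ≡ j
  transpose-matchˡ with i ≟ i
  ... | yes _  = refl
  ... | no i≢i = contradiction refl i≢i

  transpose-matchʳ : transpose i j j ≡ i
  transpose-matchʳ with j ≟ i
  ... | yes j≡i = j≡i
  ... | no _ with j ≟ j
  ...   | yes _  = refl
  ...   | no j≢j = contradiction refl j≢j

  transpose-other : ∀ {k} → k ≢ i → k ≢ j → transpose i j k ≡ k
  transpose-other {k} k≢i k≢j with k ≟ i
  ... | yes k≡i = contradiction k≡i k≢i
  ... | no _ with k ≟ j
  ...   | yes k≡j = contradiction k≡j k≢j
  ...   | no _    = refl

  data Position (k : Fin n) : Set where
    at-i      : k ≡ i → Position k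
    at-j      : k ≡ j → Position k
    elsewhere : k ≢ i → k ≢ j → Position k

  position : ∀ k → Position k
  position k with k ≟ i | k ≟ j
  ... | yes k≡i | _       = at-i k≡i
  ... | no _    | yes k≡j = at-j k≡j
  ... | no k≢i  | no k≢j  = elsewhere k≢i k≢j

  transpose-involutive : ∀ k → transpose i j (transpose i j k) ≡ k
  transpose-involutive k with position k
  ... | at-i refl = trans (cong (transpose i j) transpose-matchˡ) transpose-matchʳ
  ... | at-j refl = trans (cong (transpose i j) transpose-matchʳ) transpose-matchˡ
  ... | elsewhere k≢i k≢j =
    trans (cong (transpose i j) (transpose-other k≢i k≢j)) (transpose-other k≢i k≢j)

  transpose-preimage : ∀ {k c} → transpose i j k ≡ c → k ≡ transpose i j c
  transpose-preimage {k} σk≡c = trans (sym (transpose-involutive k)) (cong (transpose i j) σk≡c)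

  swapAt≗transpose : (α : Comp n) → ∀ k → swapAt i j α k ≡ α (transpose i j k)
  swapAt≗transpose α k with k ≟ i
  ... | yes _ = refl
  ... | no _ with k ≟ j
  ...   | yes _ = refl
  ...   | no _  = refl

  swapAt-transpose : (α : Comp n) → ∀ k → swapAt i j α (transpose i j k) ≡ α k
  swapAt-transpose α k =
    trans (swapAt≗transpose α (transpose i j k)) (cong α (transpose-involutive k))

  Transposed : Fin n → Fin n → Set
  Transposed a b = (a ≡ i × b ≡ j) ⊎ (a ≡ j × b ≡ i)

  transposed-sym : ∀ {a b} → Transposed a b → Transposed b a
  transposed-sym (inj₁ (a≡i , b≡j)) = inj₂ (b≡j , a≡i)
  transposed-sym (inj₂ (a≡j , b≡i)) = inj₁ (b≡i , a≡j)

  transpose-transposed : ∀ {a b} → Transposed (transpose i j a) (transpose i j b) → Transposed a b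
  transpose-transposed (inj₁ (σa≡i , σb≡j)) = inj₂
    (trans (transpose-preimage σa≡i) transpose-matchˡ , trans (transpose-preimage σb≡j) transpose-matchʳ)
  transpose-transposed (inj₂ (σa≡j , σb≡i)) = inj₁
    (trans (transpose-preimage σa≡j) transpose-matchʳ , trans (transpose-preimage σb≡i) transpose-matchˡ)

  module _ (adjacent : toℕ j ≡ suc (toℕ i)) where

    adjacent-< : toℕ i ℕ.< toℕ j
    adjacent-< = subst (toℕ i ℕ.<_) (sym adjacent) (ℕP.n<1+n (toℕ i))

    transpose-mono-< : ∀ {a b} → ¬ Transposed a b → toℕ a ℕ.< toℕ b →
                       toℕ (transpose i j a) ℕ.< toℕ (transpose i j b)
    transpose-mono-< {a} {b} ¬ab a<b with position a | position b
    ... | at-i refl | at-i refl = contradiction a<b (ℕP.<-irrefl refl)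
    ... | at-i refl | at-j refl = contradiction (inj₁ (refl , refl)) ¬ab
    ... | at-j refl | at-i refl = contradiction a<b (ℕP.<-asym adjacent-<)
    ... | at-j refl | at-j refl = contradiction a<b (ℕP.<-irrefl refl)
    ... | at-i refl | elsewhere b≢i b≢j
      rewrite transpose-matchˡ | transpose-other b≢i b≢j =
      ℕP.≤∧≢⇒< (subst (_≤ toℕ b) (sym adjacent) a<b) (λ j≡b → b≢j (toℕ-injective (sym j≡b)))
    ... | at-j refl | elsewhere b≢i b≢j
      rewrite transpose-matchʳ | transpose-other b≢i b≢j = ℕP.<-trans adjacent-< a<b
    ... | elsewhere a≢i a≢j | at-i refl
      rewrite transpose-other a≢i a≢j | transpose-matchˡ = ℕP.<-trans a<b adjacent-<
    ... | elsewhere a≢i a≢j | at-j refl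
      rewrite transpose-other a≢i a≢j | transpose-matchʳ =
      ℕP.≤∧≢⇒< (ℕP.≤-pred (subst (suc (toℕ a) ≤_) adjacent a<b)) (a≢i ∘ toℕ-injective)
    ... | elsewhere a≢i a≢j | elsewhere b≢i b≢j
      rewrite transpose-other a≢i a≢j | transpose-other b≢i b≢j = a<b

    transpose-<-⇔ : ∀ {a b} → ¬ Transposed a b →
                    toℕ (transpose i j a) ℕ.< toℕ (transpose i j b) ⇔ toℕ a ℕ.< toℕ b
    transpose-<-⇔ {a} {b} ¬ab = mk⇔ reflects (transpose-mono-< ¬ab)
      where
      reflects : toℕ (transpose i j a) ℕ.< toℕ (transpose i j b) → toℕ a ℕ.< toℕ b
      reflects = subst₂ (λ x y → toℕ x ℕ.< toℕ y)
                        (transpose-involutive a) (transpose-involutive b)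
               ∘ transpose-mono-< (¬ab ∘ transpose-transposed)

    transpose-≤-⇔ : ∀ {a b} → ¬ Transposed a b →
                    toℕ (transpose i j a) ≤ toℕ (transpose i j b) ⇔ toℕ a ≤ toℕ b
    transpose-≤-⇔ ¬ab = mk⇔
      (λ σa≤σb → ℕP.≮⇒≥ (ℕP.≤⇒≯ σa≤σb ∘ Equivalence.from ba))
      (λ a≤b → ℕP.≮⇒≥ (ℕP.≤⇒≯ a≤b ∘ Equivalence.to ba))
      where ba = transpose-<-⇔ (¬ab ∘ transposed-sym)

    module _ (α : Comp n) where

      private
        α′ = swapAt i j α
        σ  = transpose i j

      rank-swapAt : α i ≢ α j → ∀ k → rank α′ (σ k) ≡ rank α k
      rank-swapAt αi≢αj k = cong₂ ℕ._+_
        (count-allFin-permute _ _ (Perm.transpose i j) (λ l → mk⇔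
          (subst₂ ℕ._>_ (swapAt-transpose α l) (swapAt-transpose α k))
          (subst₂ ℕ._>_ (sym (swapAt-transpose α l)) (sym (swapAt-transpose α k)))))
        (count-allFin-permute _ _ (Perm.transpose i j) (λ l → mk⇔
          (λ (σl≤σk , e) → let αl≡αk = equal l e in
            Equivalence.to (transpose-≤-⇔ (not-transposed αl≡αk)) σl≤σk , αl≡αk)
          (λ (l≤k , αl≡αk) →
            Equivalence.from (transpose-≤-⇔ (not-transposed αl≡αk)) l≤k , unequal l αl≡αk)))
        where
        equal : ∀ l → α′ (σ l) ≡ α′ (σ k) → α l ≡ α k
        equal l e = trans (sym (swapAt-transpose α l)) (trans e (swapAt-transpose α k))
        unequal : ∀ l → α l ≡ α k → α′ (σ l) ≡ α′ (σ k)
        unequal l e = trans (swapAt-transpose α l) (trans e (sym (swapAt-transpose α k)))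
        not-transposed : ∀ {l} → α l ≡ α k → ¬ Transposed l k
        not-transposed αl≡αk (inj₁ (refl , refl)) = αi≢αj αl≡αk
        not-transposed αl≡αk (inj₂ (refl , refl)) = αi≢αj (sym αl≡αk)

      increasing-swapAt-⇔ : α j ℕ.< α i → ∀ {a b} → ¬ (a ≡ j × b ≡ i) →
        (toℕ (σ a) ℕ.< toℕ (σ b) × α′ (σ a) ℕ.< α′ (σ b)) ⇔
        (toℕ a ℕ.< toℕ b × α a ℕ.< α b)
      increasing-swapAt-⇔ αj<αi {a} {b} ¬ji = mk⇔
        (λ (σa<σb , v) → let αa<αb = values-to v in
          Equivalence.to (transpose-<-⇔ (not-transposed αa<αb)) σa<σb , αa<αb)
        (λ (a<b , αa<αb) →
          Equivalence.from (transpose-<-⇔ (not-transposed αa<αb)) a<b , values-from αa<αb)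
        where
        values-to : α′ (σ a) ℕ.< α′ (σ b) → α a ℕ.< α b
        values-to = subst₂ ℕ._<_ (swapAt-transpose α a) (swapAt-transpose α b)
        values-from : α a ℕ.< α b → α′ (σ a) ℕ.< α′ (σ b)
        values-from = subst₂ ℕ._<_ (sym (swapAt-transpose α a)) (sym (swapAt-transpose α b))
        not-transposed : α a ℕ.< α b → ¬ Transposed a b
        not-transposed αa<αb (inj₁ (refl , refl)) = ℕP.<-asym αa<αb αj<αi
        not-transposed αa<αb (inj₂ ab≡ji)         = ¬ji ab≡ji

module _ {N τ} (T : RSYT N τ) (κ ε : ℚ) where

  factor : Comp N → Fin N → Fin N → ℚ
  factor β a b = 1ℚ + ε * κ * inv (denom T κ β a b)

  Increasing? : (β : Comp N) (a b : Fin N) → Dec (toℕ a ℕ.< toℕ b × β a ℕ.< β b)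
  Increasing? β a b = (toℕ a ℕP.<? toℕ b) ×-dec (β a ℕP.<? β b)

  factorIf : Comp N → Fin N → Fin N → ℚ
  factorIf β a b = if does (Increasing? β a b) then factor β a b else 1ℚ

  𝓔≡∏∏ : (β : Comp N) → 𝓔 T κ ε β ≡ ∏ λ a → ∏ λ b → factorIf β a b
  𝓔≡∏∏ β = begin
    𝓔 T κ ε β
      ≡⟨ prodℚ-map-filter (λ p → Increasing? β (proj₁ p) (proj₂ p))
                          (λ p → factor β (proj₁ p) (proj₂ p)) (concatMap row (allFin N)) ⟩
    prodℚ (map factorIfᵖ (concatMap row (allFin N)))
      ≡⟨ prodℚ-map-concatMap factorIfᵖ row (allFin N) ⟩
    prodℚ (map (λ a → prodℚ (map factorIfᵖ (row a))) (allFin N))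
      ≡⟨ prodℚ-map-allFin (λ a → prodℚ (map factorIfᵖ (row a))) ⟩
    ∏ (λ a → prodℚ (map factorIfᵖ (row a)))
      ≡⟨ ∏-cong (λ a → trans (cong prodℚ (sym (ListP.map-∘ (allFin N))))
                             (prodℚ-map-allFin (factorIf β a))) ⟩
    ∏ (λ a → ∏ λ b → factorIf β a b) ∎
    where
    open ≡-Reasoning
    factorIfᵖ : Fin N × Fin N → ℚ
    factorIfᵖ p = factorIf β (proj₁ p) (proj₂ p)
    row : Fin N → List (Fin N × Fin N)
    row a = map (a ,_) (allFin N)

  module _ (i j : Fin N) (adjacent : toℕ j ≡ suc (toℕ i))
           (α : Comp N) (αj<αi : α j ℕ.< α i) where

    private
      α′ = swapAt i j α
      σ  = transpose i j

      αi≢αj : α i ≢ α j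
      αi≢αj αi≡αj = ℕP.<-irrefl (sym αi≡αj) αj<αi

    denom-swapAt : ∀ a b → denom T κ α′ (σ a) (σ b) ≡ denom T κ α a b
    denom-swapAt a b = trans
      (cong₂ (λ x y → denomOf x y (rank α′ (σ a)) (rank α′ (σ b)))
             (swapAt-transpose i j α a) (swapAt-transpose i j α b))
      (cong₂ (denomOf (α a) (α b))
             (rank-swapAt i j adjacent α αi≢αj a) (rank-swapAt i j adjacent α αi≢αj b))
      where
      denomOf : ℕ → ℕ → ℕ → ℕ → ℚ
      denomOf x y r s = toℚ ((+ y) ℤ.- (+ x)) + κ * toℚ (content T s ℤ.- content T r)

    factor-swapAt : ∀ a b → factor α′ (σ a) (σ b) ≡ factor α a b
    factor-swapAt a b = cong (λ d → 1ℚ + ε * κ * inv d) (denom-swapAt a b)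

    factorIf-swapAt-ji : factorIf α′ (σ j) (σ i) ≡ factorIf α j i * factor α j i
    factorIf-swapAt-ji = begin
      factorIf α′ (σ j) (σ i)
        ≡⟨ cong₂ (λ c x → if c then x else 1ℚ) contributes (factor-swapAt j i) ⟩
      factor α j i
        ≡⟨ ℚP.*-identityˡ _ ⟨
      1ℚ * factor α j i
        ≡⟨ cong (λ c → (if c then factor α j i else 1ℚ) * factor α j i) omitted ⟨
      factorIf α j i * factor α j i ∎
      where
      open ≡-Reasoning
      contributes : does (Increasing? α′ (σ j) (σ i)) ≡ true
      contributes = dec-true (Increasing? α′ (σ j) (σ i))
        ( subst₂ (λ x y → toℕ x ℕ.< toℕ y) (sym (transpose-matchʳ i j)) (sym (transpose-matchˡ i j))
                 (adjacent-< i j adjacent)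
        , subst₂ ℕ._<_ (sym (swapAt-transpose i j α j)) (sym (swapAt-transpose i j α i)) αj<αi)
      omitted : does (Increasing? α j i) ≡ false
      omitted = dec-false (Increasing? α j i) (ℕP.<-asym (adjacent-< i j adjacent) ∘ proj₁)

    factorIf-swapAt-other : ∀ a b → ¬ (a ≡ j × b ≡ i) →
                            factorIf α′ (σ a) (σ b) ≡ factorIf α a b
    factorIf-swapAt-other a b ¬ji = cong₂ (λ c x → if c then x else 1ℚ)
      (does-⇔ (increasing-swapAt-⇔ i j adjacent α αj<αi ¬ji)
              (Increasing? α′ (σ a) (σ b)) (Increasing? α a b))
      (factor-swapAt a b)

    factorIf-swapAt : ∀ a b → factorIf α′ (σ a) (σ b) ≡
      factorIf α a b * (if does ((a ≟ j) ×-dec (b ≟ i)) then factor α j i else 1ℚ)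
    factorIf-swapAt a b = by-cases (a ≟ j) (b ≟ i)
      where
      by-cases : (a≟j : Dec (a ≡ j)) (b≟i : Dec (b ≡ i)) → factorIf α′ (σ a) (σ b) ≡
        factorIf α a b * (if does (a≟j ×-dec b≟i) then factor α j i else 1ℚ)
      by-cases (yes a≡j) (yes b≡i) =
        subst₂ (λ x y → factorIf α′ (σ x) (σ y) ≡ factorIf α x y * factor α j i)
               (sym a≡j) (sym b≡i) factorIf-swapAt-ji
      by-cases (no a≢j) _ =
        trans (factorIf-swapAt-other a b (a≢j ∘ proj₁)) (sym (ℚP.*-identityʳ _))
      by-cases (yes _) (no b≢i) =
        trans (factorIf-swapAt-other a b (b≢i ∘ proj₂)) (sym (ℚP.*-identityʳ _))

    𝓔-swapAt : 𝓔 T κ ε α′ ≡ 𝓔 T κ ε α * factor α j i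
    𝓔-swapAt = begin
      𝓔 T κ ε α′
        ≡⟨ 𝓔≡∏∏ α′ ⟩
      ∏ (λ a → ∏ (λ b → factorIf α′ a b))
        ≡⟨ ∏-permute (λ a → ∏ (factorIf α′ a)) π ⟩
      ∏ (λ a → ∏ (λ b → factorIf α′ (σ a) b))
        ≡⟨ ∏-cong (λ a → ∏-permute (factorIf α′ (σ a)) π) ⟩
      ∏ (λ a → ∏ (λ b → factorIf α′ (σ a) (σ b)))
        ≡⟨ ∏-cong (λ a → ∏-cong (factorIf-swapAt a)) ⟩
      ∏ (λ a → ∏ (λ b → factorIf α a b * δ a b))
        ≡⟨ ∏-cong (λ a → ∏-distrib-* (factorIf α a) (δ a)) ⟩
      ∏ (λ a → ∏ (factorIf α a) * ∏ (δ a))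
        ≡⟨ ∏-distrib-* (λ a → ∏ (factorIf α a)) (λ a → ∏ (δ a)) ⟩
      ∏ (λ a → ∏ (factorIf α a)) * ∏ (λ a → ∏ (δ a))
        ≡⟨ cong₂ _*_ (sym (𝓔≡∏∏ α)) (∏∏-single j i (factor α j i)) ⟩
      𝓔 T κ ε α * factor α j i ∎
      where
      open ≡-Reasoning
      π = Perm.transpose i j
      δ : Fin N → Fin N → ℚ
      δ a b = if does ((a ≟ j) ×-dec (b ≟ i)) then factor α j i else 1ℚ

*-inv : ∀ q → q ≢ 0ℚ → q * inv q ≡ 1ℚ
*-inv q q≢0 with q ℚP.≟ 0ℚ
... | yes q≡0 = contradiction q≡0 q≢0
... | no q≢0′ = ℚP.*-inverseʳ q {{≢-nonZero q≢0′}}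

*-inv-cancelʳ : ∀ q r → q ≢ 0ℚ → q * r * inv q ≡ r
*-inv-cancelʳ q r q≢0 = begin
  q * r * inv q   ≡⟨ ℚP.*-assoc q r (inv q) ⟩
  q * (r * inv q) ≡⟨ cong (q *_) (ℚP.*-comm r (inv q)) ⟩
  q * (inv q * r) ≡⟨ ℚP.*-assoc q (inv q) r ⟨
  q * inv q * r   ≡⟨ cong (_* r) (*-inv q q≢0) ⟩
  1ℚ * r          ≡⟨ ℚP.*-identityˡ r ⟩
  r               ∎
  where open ≡-Reasoning

mainTheorem12 : (N : ℕ) → 2 ≤ N → (τ : List ℕ) → IsPartition N τ →
    (α : Comp N) → (T : RSYT N τ) → (ε : ℚ) → (ε ≡ 1ℚ ⊎ ε ≡ - 1ℚ) →
    (i j : Fin N) → toℕ j ≡ suc (toℕ i) → α i > α j →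
    (κ : ℚ) → Admissible T κ ε α i j →
    𝓔 T κ ε (swapAt i j α) * inv (𝓔 T κ ε α) ≡ 1ℚ + ε * bCoeff T κ α i j
mainTheorem12 N _ τ _ α T ε _ i j adjacent αj<αi κ (_ , _ , _ , 𝓔α≢0) = begin
  𝓔 T κ ε (swapAt i j α) * inv (𝓔 T κ ε α)
    ≡⟨ cong (_* inv (𝓔 T κ ε α)) (𝓔-swapAt T κ ε i j adjacent α αj<αi) ⟩
  𝓔 T κ ε α * factor T κ ε α j i * inv (𝓔 T κ ε α)
    ≡⟨ *-inv-cancelʳ _ _ 𝓔α≢0 ⟩
  1ℚ + ε * κ * inv (bDenom T κ α i j)
    ≡⟨ cong (λ x → 1ℚ + x) (ℚP.*-assoc ε κ _) ⟩
  1ℚ + ε * bCoeff T κ α i j ∎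
  where open ≡-Reasoning
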